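{- Let $p$ be a process and $\sigma$ a substitution for variables of any kind. If $p$ is $\delta$-like (resp. stuck, non-terminating) then $p\sigma$ is also $\delta$-like (resp. stuck, non-terminating).
   Context: Fix pairwise disjoint countably infinite sets of $\lambda$-variables ($x,y,\dots$), stack variables ($\alpha,\beta,\dots$), term variables ($a,b,\dots$), and countable sets of labels $l$ and constructors $C$. Values, terms, stacks, processes: $v,w::=x\mid\lambda x\,t\mid C[v]\mid\{l_i=v_i\}_{i\in I}$; $t,u::=a\mid v\mid t\,u\mid\mu\alpha\,t\mid p\mid v.l\mid\mathrm{case}_v[C_i[x_i]\to t_i]_{i\in I}\mid\delta_{v,w}$; $\pi::=\alpha\mid v.\pi\mid[t]\pi$; $p::=t\ast\pi$; $I$ finite; $\lambda x$, $\mu\alpha$ and the $x_i$ in case branches are binders, term variables are never bound. A substitution maps $\lambda$-variables to values, stack variables to stacks and term variables to terms (capture-avoiding). $\succ$ is the smallest relation on processes with: $t\,u\ast\pi\succ u\ast[t]\pi$; $v\ast[t]\pi\succ t\ast v.\pi$; $\lambda x\,t\ast v.\pi\succ t[x:=v]\ast\pi$; $\mu\alpha\,t\ast\pi\succ t[\alpha:=\pi]\ast\pi$; $p\ast\pi\succ p$; $\{l_i=v_i\}_{i\in I}.l_k\ast\pi\succ v_k\ast\pi$ ($k\in I$); $\mathrm{case}_{C_k[v]}[C_i[x_i]\to t_i]_{i\in I}\ast\pi\succ t_k[x_k:=v]\ast\pi$ ($k\in I$). A process $p$ is: final if $p=v\ast\alpha$ for a value $v$ and stack variable $\alpha$; $\delta$-like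 if $p=\delta_{v,w}\ast\pi$; blocked if there is no $q$ with $p\succ q$; stuck if it is neither final nor $\delta$-like and $p\sigma$ is blocked for every substitution $\sigma$; non-terminating if there is no blocked $q$ with $p\succ^*q$. -}

module Defs where

open import Data.Nat using (ℕ; zero; suc)
open import Data.Product using (Σ; _×_; _,_)
open import Relation.Binary.PropositionalEquality using (_≡_)
open import Relation.Nullary using (¬_)
open import Relation.Binary.Construct.Closure.ReflexiveTransitive using (Star)

-- Bound variables (λ-variables and stack variables) are
-- represented by de Bruijn indices; free ones are the indices escaping
-- all binders.  Term variables are never bound and are simply named by ℕ.

Label : Set
Label = ℕ

Constr : Set
Constr = ℕ

infix 5 _∗_

mutual
  data Val : Set where
    var  : ℕ → Val
    lam  : Term → Val              -- λx t  (binds λ-variable 0 in t)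
    con  : Constr → Val → Val
    rec  : Fields → Val

  data Fields : Set where
    []    : Fields
    fld : Label → Val → Fields → Fields

  data Term : Set where
    tvar  : ℕ → Term
    val   : Val → Term
    app   : Term → Term → Term
    mu    : Term → Term            -- μα t  (binds stack variable 0 in t)
    proc  : Proc → Term
    proj  : Val → Label → Term
    case  : Val → Branches → Term
    delta : Val → Val → Term

  data Branches : Set where
    []     : Branches
    branch : Constr → Term → Branches → Branches
    -- branch C t bs : C[x] → t, where t binds λ-variable 0 (that is x)

  data Stack : Set where
    svar  : ℕ → Stack
    push  : Val → Stack → Stack
    frame : Term → Stack → Stack

  data Proc : Set where
    _∗_ : Term → Stack → Proc

record Ren : Set where
  constructor ren
  field
    rλ : ℕ → ℕ
    rμ : ℕ → ℕ
open Ren public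

ext : (ℕ → ℕ) → ℕ → ℕ
ext r zero    = zero
ext r (suc n) = suc (r n)

liftRλ : Ren → Ren
liftRλ ρ = ren (ext (rλ ρ)) (rμ ρ)

liftRμ : Ren → Ren
liftRμ ρ = ren (rλ ρ) (ext (rμ ρ))

mutual
  renV : Ren → Val → Val
  renV ρ (var x)   = var (rλ ρ x)
  renV ρ (lam t)   = lam (renT (liftRλ ρ) t)
  renV ρ (con C v) = con C (renV ρ v)
  renV ρ (rec fs)  = rec (renF ρ fs)

  renF : Ren → Fields → Fields
  renF ρ []             = []
  renF ρ (fld l v fs) = fld l (renV ρ v) (renF ρ fs)

  renT : Ren → Term → Term
  renT ρ (tvar a)    = tvar a
  renT ρ (val v)     = val (renV ρ v)
  renT ρ (app t u)   = app (renT ρ t) (renT ρ u)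
  renT ρ (mu t)      = mu (renT (liftRμ ρ) t)
  renT ρ (proc p)    = proc (renP ρ p)
  renT ρ (proj v l)  = proj (renV ρ v) l
  renT ρ (case v bs) = case (renV ρ v) (renB ρ bs)
  renT ρ (delta v w) = delta (renV ρ v) (renV ρ w)

  renB : Ren → Branches → Branches
  renB ρ []               = []
  renB ρ (branch C t bs)  = branch C (renT (liftRλ ρ) t) (renB ρ bs)

  renS : Ren → Stack → Stack
  renS ρ (svar α)    = svar (rμ ρ α)
  renS ρ (push v π)  = push (renV ρ v) (renS ρ π)
  renS ρ (frame t π) = frame (renT ρ t) (renS ρ π)

  renP : Ren → Proc → Proc
  renP ρ (t ∗ π) = renT ρ t ∗ renS ρ π

wkλ : Ren
wkλ = ren suc (λ n → n)

wkμ : Ren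
wkμ = ren (λ n → n) suc

record Subst : Set where
  constructor sub
  field
    σλ : ℕ → Val
    σμ : ℕ → Stack
    σt : ℕ → Term
open Subst public

liftλ : Subst → Subst
liftλ σ = sub f (λ n → renS wkλ (σμ σ n)) (λ n → renT wkλ (σt σ n))
  where
  f : ℕ → Val
  f zero    = var zero
  f (suc n) = renV wkλ (σλ σ n)

liftμ : Subst → Subst
liftμ σ = sub (λ n → renV wkμ (σλ σ n)) g (λ n → renT wkμ (σt σ n))
  where
  g : ℕ → Stack
  g zero    = svar zero
  g (suc n) = renS wkμ (σμ σ n)

mutual
  substV : Subst → Val → Val
  substV σ (var x)   = σλ σ x
  substV σ (lam t)   = lam (substT (liftλ σ) t)
  substV σ (con C v) = con C (substV σ v)
  substV σ (rec fs)  = rec (substF σ fs)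

  substF : Subst → Fields → Fields
  substF σ []             = []
  substF σ (fld l v fs) = fld l (substV σ v) (substF σ fs)

  substT : Subst → Term → Term
  substT σ (tvar a)    = σt σ a
  substT σ (val v)     = val (substV σ v)
  substT σ (app t u)   = app (substT σ t) (substT σ u)
  substT σ (mu t)      = mu (substT (liftμ σ) t)
  substT σ (proc p)    = proc (substP σ p)
  substT σ (proj v l)  = proj (substV σ v) l
  substT σ (case v bs) = case (substV σ v) (substB σ bs)
  substT σ (delta v w) = delta (substV σ v) (substV σ w)

  substB : Subst → Branches → Branches
  substB σ []              = []
  substB σ (branch C t bs) = branch C (substT (liftλ σ) t) (substB σ bs)

  substS : Subst → Stack → Stack
  substS σ (svar α)    = σμ σ α
  substS σ (push v π)  = push (substV σ v) (substS σ π)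
  substS σ (frame t π) = frame (substT σ t) (substS σ π)

  substP : Subst → Proc → Proc
  substP σ (t ∗ π) = substT σ t ∗ substS σ π

idSubst : Subst
idSubst = sub var svar tvar

_[λ:=_] : Term → Val → Term
t [λ:= v ] = substT (sub f svar tvar) t
  where
  f : ℕ → Val
  f zero    = v
  f (suc n) = var n

_[μ:=_] : Term → Stack → Term
t [μ:= π ] = substT (sub var g tvar) t
  where
  g : ℕ → Stack
  g zero    = π
  g (suc n) = svar n

data _↦_∈F_ (l : Label) (v : Val) : Fields → Set where
  here  : ∀ {fs} → l ↦ v ∈F fld l v fs
  there : ∀ {l′ v′ fs} → l ↦ v ∈F fs → l ↦ v ∈F fld l′ v′ fs

data _⇒_∈B_ (C : Constr) (t : Term) : Branches → Set where
  here  : ∀ {bs} → C ⇒ t ∈B branch C t bs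
  there : ∀ {C′ t′ bs} → C ⇒ t ∈B bs → C ⇒ t ∈B branch C′ t′ bs

infix 4 _≻_ _≻*_

data _≻_ : Proc → Proc → Set where
  ≻-app   : ∀ {t u π} → app t u ∗ π ≻ u ∗ frame t π
  ≻-val   : ∀ {v t π} → val v ∗ frame t π ≻ t ∗ push v π
  ≻-beta  : ∀ {t v π} → val (lam t) ∗ push v π ≻ (t [λ:= v ]) ∗ π
  ≻-mu    : ∀ {t π} → mu t ∗ π ≻ (t [μ:= π ]) ∗ π
  ≻-proc  : ∀ {p π} → proc p ∗ π ≻ p
  ≻-proj  : ∀ {fs l v π} → l ↦ v ∈F fs → proj (rec fs) l ∗ π ≻ val v ∗ π
  ≻-case  : ∀ {bs C t v π} → C ⇒ t ∈B bs →
            case (con C v) bs ∗ π ≻ (t [λ:= v ]) ∗ π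

_≻*_ : Proc → Proc → Set
_≻*_ = Star _≻_

Final : Proc → Set
Final p = Σ Val λ v → Σ ℕ λ α → p ≡ (val v ∗ svar α)

DeltaLike : Proc → Set
DeltaLike p = Σ Val λ v → Σ Val λ w → Σ Stack λ π → p ≡ (delta v w ∗ π)

Blocked : Proc → Set
Blocked p = ¬ (Σ Proc λ q → p ≻ q)

Stuck : Proc → Set
Stuck p = ¬ Final p × ¬ DeltaLike p × ((σ : Subst) → Blocked (substP σ p))

NonTerminating : Proc → Set
NonTerminating p = ¬ (Σ Proc λ q → (p ≻* q) × Blocked q)

-- A δ-like process is recognised by its shape alone, which substitution preserves.
--
-- Reduction commutes with substitution: a step p ≻ q gives pσ ≻ qσ (for β and μ by
-- the substitution lemma), and conversely, when p is reducible, every step of pσ is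
-- the image of a step of p. Walking along a reduction of pσ, every process met is
-- p′σ for a reduct p′ of the non-terminating p; so p′ reduces, and so does p′σ.
--
-- A stuck process has one of a few shapes that block reduction whatever the free
-- variables stand for: a constructor or record applied to an argument, a projection
-- out of an abstraction, a constructor or a record lacking the label, a case on an
-- abstraction, a record, a constructor without matching branch, or a variable with
-- no branches at all. Any other shape either reduces or is made to reduce by a
-- suitable substitution, and the stuck shapes are closed under substitution.
module Submission where

open import Defs
open import Data.Nat using (ℕ; zero; suc; _≟_)
open import Data.Product using (∃; _×_; _,_)
open import Data.Empty using (⊥; ⊥-elim)
open import Relation.Nullary using (¬_; Dec; yes; no)
open import Relation.Binary.PropositionalEquality
  using (_≡_; refl; sym; trans; cong; cong₂; module ≡-Reasoning)
open import Relation.Binary.Construct.Closure.ReflexiveTransitive using (ε; _◅_)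

infixr 5 _∷ₙ_

_∷ₙ_ : {A : Set} → A → (ℕ → A) → ℕ → A
(a ∷ₙ f) zero    = a
(a ∷ₙ f) (suc n) = f n

record RenRen (ρ₁ ρ₂ ρ₃ : Ren) : Set where
  constructor mkRR
  field
    rrλ : ∀ x → rλ ρ₂ (rλ ρ₁ x) ≡ rλ ρ₃ x
    rrμ : ∀ x → rμ ρ₂ (rμ ρ₁ x) ≡ rμ ρ₃ x
open RenRen

ext-∘ : {f g h : ℕ → ℕ} → (∀ x → f (g x) ≡ h x) → ∀ x → ext f (ext g x) ≡ ext h x
ext-∘ e zero    = refl
ext-∘ e (suc x) = cong suc (e x)

RenRen-liftλ : ∀ {ρ₁ ρ₂ ρ₃} → RenRen ρ₁ ρ₂ ρ₃ → RenRen (liftRλ ρ₁) (liftRλ ρ₂) (liftRλ ρ₃)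
RenRen-liftλ e = mkRR (ext-∘ (rrλ e)) (rrμ e)

RenRen-liftμ : ∀ {ρ₁ ρ₂ ρ₃} → RenRen ρ₁ ρ₂ ρ₃ → RenRen (liftRμ ρ₁) (liftRμ ρ₂) (liftRμ ρ₃)
RenRen-liftμ e = mkRR (rrλ e) (ext-∘ (rrμ e))

mutual
  renV-renV : ∀ {ρ₁ ρ₂ ρ₃} → RenRen ρ₁ ρ₂ ρ₃ → ∀ v → renV ρ₂ (renV ρ₁ v) ≡ renV ρ₃ v
  renV-renV e (var x)   = cong var (rrλ e x)
  renV-renV e (lam t)   = cong lam (renT-renT (RenRen-liftλ e) t)
  renV-renV e (con C v) = cong (con C) (renV-renV e v)
  renV-renV e (rec fs)  = cong rec (renF-renF e fs)

  renF-renF : ∀ {ρ₁ ρ₂ ρ₃} → RenRen ρ₁ ρ₂ ρ₃ → ∀ fs → renF ρ₂ (renF ρ₁ fs) ≡ renF ρ₃ fs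
  renF-renF e []           = refl
  renF-renF e (fld l v fs) = cong₂ (fld l) (renV-renV e v) (renF-renF e fs)

  renT-renT : ∀ {ρ₁ ρ₂ ρ₃} → RenRen ρ₁ ρ₂ ρ₃ → ∀ t → renT ρ₂ (renT ρ₁ t) ≡ renT ρ₃ t
  renT-renT e (tvar a)    = refl
  renT-renT e (val v)     = cong val (renV-renV e v)
  renT-renT e (app t u)   = cong₂ app (renT-renT e t) (renT-renT e u)
  renT-renT e (mu t)      = cong mu (renT-renT (RenRen-liftμ e) t)
  renT-renT e (proc p)    = cong proc (renP-renP e p)
  renT-renT e (proj v l)  = cong (λ w → proj w l) (renV-renV e v)
  renT-renT e (case v bs) = cong₂ case (renV-renV e v) (renB-renB e bs)
  renT-renT e (delta v w) = cong₂ delta (renV-renV e v) (renV-renV e w)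

  renB-renB : ∀ {ρ₁ ρ₂ ρ₃} → RenRen ρ₁ ρ₂ ρ₃ → ∀ bs → renB ρ₂ (renB ρ₁ bs) ≡ renB ρ₃ bs
  renB-renB e []              = refl
  renB-renB e (branch C t bs) = cong₂ (branch C) (renT-renT (RenRen-liftλ e) t) (renB-renB e bs)

  renS-renS : ∀ {ρ₁ ρ₂ ρ₃} → RenRen ρ₁ ρ₂ ρ₃ → ∀ π → renS ρ₂ (renS ρ₁ π) ≡ renS ρ₃ π
  renS-renS e (svar α)    = cong svar (rrμ e α)
  renS-renS e (push v π)  = cong₂ push (renV-renV e v) (renS-renS e π)
  renS-renS e (frame t π) = cong₂ frame (renT-renT e t) (renS-renS e π)

  renP-renP : ∀ {ρ₁ ρ₂ ρ₃} → RenRen ρ₁ ρ₂ ρ₃ → ∀ p → renP ρ₂ (renP ρ₁ p) ≡ renP ρ₃ p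
  renP-renP e (t ∗ π) = cong₂ _∗_ (renT-renT e t) (renS-renS e π)

module _ {ρ₁ ρ₂ ρ₃ ρ₄ ρ : Ren} (e₁₂ : RenRen ρ₁ ρ₂ ρ) (e₃₄ : RenRen ρ₃ ρ₄ ρ) where

  renV-square : ∀ v → renV ρ₂ (renV ρ₁ v) ≡ renV ρ₄ (renV ρ₃ v)
  renV-square v = trans (renV-renV e₁₂ v) (sym (renV-renV e₃₄ v))

  renT-square : ∀ t → renT ρ₂ (renT ρ₁ t) ≡ renT ρ₄ (renT ρ₃ t)
  renT-square t = trans (renT-renT e₁₂ t) (sym (renT-renT e₃₄ t))

  renS-square : ∀ π → renS ρ₂ (renS ρ₁ π) ≡ renS ρ₄ (renS ρ₃ π)
  renS-square π = trans (renS-renS e₁₂ π) (sym (renS-renS e₃₄ π))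

module _ (ρ : Ren) where

  private
    wkλ-then-liftRλ : RenRen wkλ (liftRλ ρ) (ren (λ x → suc (rλ ρ x)) (rμ ρ))
    wkλ-then-liftRλ = mkRR (λ _ → refl) (λ _ → refl)

    then-wkλ : RenRen ρ wkλ (ren (λ x → suc (rλ ρ x)) (rμ ρ))
    then-wkλ = mkRR (λ _ → refl) (λ _ → refl)

    wkμ-then-liftRμ : RenRen wkμ (liftRμ ρ) (ren (rλ ρ) (λ x → suc (rμ ρ x)))
    wkμ-then-liftRμ = mkRR (λ _ → refl) (λ _ → refl)

    then-wkμ : RenRen ρ wkμ (ren (rλ ρ) (λ x → suc (rμ ρ x)))
    then-wkμ = mkRR (λ _ → refl) (λ _ → refl)

  renV-liftRλ-wkλ : ∀ v → renV (liftRλ ρ) (renV wkλ v) ≡ renV wkλ (renV ρ v)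
  renV-liftRλ-wkλ = renV-square wkλ-then-liftRλ then-wkλ

  renT-liftRλ-wkλ : ∀ t → renT (liftRλ ρ) (renT wkλ t) ≡ renT wkλ (renT ρ t)
  renT-liftRλ-wkλ = renT-square wkλ-then-liftRλ then-wkλ

  renS-liftRλ-wkλ : ∀ π → renS (liftRλ ρ) (renS wkλ π) ≡ renS wkλ (renS ρ π)
  renS-liftRλ-wkλ = renS-square wkλ-then-liftRλ then-wkλ

  renV-liftRμ-wkμ : ∀ v → renV (liftRμ ρ) (renV wkμ v) ≡ renV wkμ (renV ρ v)
  renV-liftRμ-wkμ = renV-square wkμ-then-liftRμ then-wkμ

  renT-liftRμ-wkμ : ∀ t → renT (liftRμ ρ) (renT wkμ t) ≡ renT wkμ (renT ρ t)
  renT-liftRμ-wkμ = renT-square wkμ-then-liftRμ then-wkμ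

  renS-liftRμ-wkμ : ∀ π → renS (liftRμ ρ) (renS wkμ π) ≡ renS wkμ (renS ρ π)
  renS-liftRμ-wkμ = renS-square wkμ-then-liftRμ then-wkμ

record RenSub (ρ : Ren) (σ σ′ : Subst) : Set where
  constructor mkRS
  field
    rsλ : ∀ x → renV ρ (σλ σ x) ≡ σλ σ′ x
    rsμ : ∀ α → renS ρ (σμ σ α) ≡ σμ σ′ α
    rst : ∀ a → renT ρ (σt σ a) ≡ σt σ′ a
open RenSub

RenSub-liftλ : ∀ {ρ σ σ′} → RenSub ρ σ σ′ → RenSub (liftRλ ρ) (liftλ σ) (liftλ σ′)
RenSub-liftλ {ρ} {σ} {σ′} e = mkRS rs-zero-suc
  (λ α → trans (renS-liftRλ-wkλ ρ (σμ σ α)) (cong (renS wkλ) (rsμ e α)))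
  (λ a → trans (renT-liftRλ-wkλ ρ (σt σ a)) (cong (renT wkλ) (rst e a)))
  where
  rs-zero-suc : ∀ x → renV (liftRλ ρ) (σλ (liftλ σ) x) ≡ σλ (liftλ σ′) x
  rs-zero-suc zero    = refl
  rs-zero-suc (suc x) = trans (renV-liftRλ-wkλ ρ (σλ σ x)) (cong (renV wkλ) (rsλ e x))

RenSub-liftμ : ∀ {ρ σ σ′} → RenSub ρ σ σ′ → RenSub (liftRμ ρ) (liftμ σ) (liftμ σ′)
RenSub-liftμ {ρ} {σ} {σ′} e = mkRS
  (λ x → trans (renV-liftRμ-wkμ ρ (σλ σ x)) (cong (renV wkμ) (rsλ e x)))
  rs-zero-suc
  (λ a → trans (renT-liftRμ-wkμ ρ (σt σ a)) (cong (renT wkμ) (rst e a)))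
  where
  rs-zero-suc : ∀ α → renS (liftRμ ρ) (σμ (liftμ σ) α) ≡ σμ (liftμ σ′) α
  rs-zero-suc zero    = refl
  rs-zero-suc (suc α) = trans (renS-liftRμ-wkμ ρ (σμ σ α)) (cong (renS wkμ) (rsμ e α))

mutual
  renV-substV : ∀ {ρ σ σ′} → RenSub ρ σ σ′ → ∀ v → renV ρ (substV σ v) ≡ substV σ′ v
  renV-substV e (var x)   = rsλ e x
  renV-substV e (lam t)   = cong lam (renT-substT (RenSub-liftλ e) t)
  renV-substV e (con C v) = cong (con C) (renV-substV e v)
  renV-substV e (rec fs)  = cong rec (renF-substF e fs)

  renF-substF : ∀ {ρ σ σ′} → RenSub ρ σ σ′ → ∀ fs → renF ρ (substF σ fs) ≡ substF σ′ fs
  renF-substF e []           = refl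
  renF-substF e (fld l v fs) = cong₂ (fld l) (renV-substV e v) (renF-substF e fs)

  renT-substT : ∀ {ρ σ σ′} → RenSub ρ σ σ′ → ∀ t → renT ρ (substT σ t) ≡ substT σ′ t
  renT-substT e (tvar a)    = rst e a
  renT-substT e (val v)     = cong val (renV-substV e v)
  renT-substT e (app t u)   = cong₂ app (renT-substT e t) (renT-substT e u)
  renT-substT e (mu t)      = cong mu (renT-substT (RenSub-liftμ e) t)
  renT-substT e (proc p)    = cong proc (renP-substP e p)
  renT-substT e (proj v l)  = cong (λ w → proj w l) (renV-substV e v)
  renT-substT e (case v bs) = cong₂ case (renV-substV e v) (renB-substB e bs)
  renT-substT e (delta v w) = cong₂ delta (renV-substV e v) (renV-substV e w)

  renB-substB : ∀ {ρ σ σ′} → RenSub ρ σ σ′ → ∀ bs → renB ρ (substB σ bs) ≡ substB σ′ bs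
  renB-substB e []              = refl
  renB-substB e (branch C t bs) = cong₂ (branch C) (renT-substT (RenSub-liftλ e) t) (renB-substB e bs)

  renS-substS : ∀ {ρ σ σ′} → RenSub ρ σ σ′ → ∀ π → renS ρ (substS σ π) ≡ substS σ′ π
  renS-substS e (svar α)    = rsμ e α
  renS-substS e (push v π)  = cong₂ push (renV-substV e v) (renS-substS e π)
  renS-substS e (frame t π) = cong₂ frame (renT-substT e t) (renS-substS e π)

  renP-substP : ∀ {ρ σ σ′} → RenSub ρ σ σ′ → ∀ p → renP ρ (substP σ p) ≡ substP σ′ p
  renP-substP e (t ∗ π) = cong₂ _∗_ (renT-substT e t) (renS-substS e π)

record SubRen (ρ : Ren) (σ σ′ : Subst) : Set where
  constructor mkSR
  field
    srλ : ∀ x → σλ σ (rλ ρ x) ≡ σλ σ′ x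
    srμ : ∀ α → σμ σ (rμ ρ α) ≡ σμ σ′ α
    srt : ∀ a → σt σ a ≡ σt σ′ a
open SubRen

SubRen-liftλ : ∀ {ρ σ σ′} → SubRen ρ σ σ′ → SubRen (liftRλ ρ) (liftλ σ) (liftλ σ′)
SubRen-liftλ {ρ} {σ} {σ′} e =
  mkSR sr-zero-suc (λ α → cong (renS wkλ) (srμ e α)) (λ a → cong (renT wkλ) (srt e a))
  where
  sr-zero-suc : ∀ x → σλ (liftλ σ) (ext (rλ ρ) x) ≡ σλ (liftλ σ′) x
  sr-zero-suc zero    = refl
  sr-zero-suc (suc x) = cong (renV wkλ) (srλ e x)

SubRen-liftμ : ∀ {ρ σ σ′} → SubRen ρ σ σ′ → SubRen (liftRμ ρ) (liftμ σ) (liftμ σ′)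
SubRen-liftμ {ρ} {σ} {σ′} e =
  mkSR (λ x → cong (renV wkμ) (srλ e x)) sr-zero-suc (λ a → cong (renT wkμ) (srt e a))
  where
  sr-zero-suc : ∀ α → σμ (liftμ σ) (ext (rμ ρ) α) ≡ σμ (liftμ σ′) α
  sr-zero-suc zero    = refl
  sr-zero-suc (suc α) = cong (renS wkμ) (srμ e α)

mutual
  substV-renV : ∀ {ρ σ σ′} → SubRen ρ σ σ′ → ∀ v → substV σ (renV ρ v) ≡ substV σ′ v
  substV-renV e (var x)   = srλ e x
  substV-renV e (lam t)   = cong lam (substT-renT (SubRen-liftλ e) t)
  substV-renV e (con C v) = cong (con C) (substV-renV e v)
  substV-renV e (rec fs)  = cong rec (substF-renF e fs)

  substF-renF : ∀ {ρ σ σ′} → SubRen ρ σ σ′ → ∀ fs → substF σ (renF ρ fs) ≡ substF σ′ fs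
  substF-renF e []           = refl
  substF-renF e (fld l v fs) = cong₂ (fld l) (substV-renV e v) (substF-renF e fs)

  substT-renT : ∀ {ρ σ σ′} → SubRen ρ σ σ′ → ∀ t → substT σ (renT ρ t) ≡ substT σ′ t
  substT-renT e (tvar a)    = srt e a
  substT-renT e (val v)     = cong val (substV-renV e v)
  substT-renT e (app t u)   = cong₂ app (substT-renT e t) (substT-renT e u)
  substT-renT e (mu t)      = cong mu (substT-renT (SubRen-liftμ e) t)
  substT-renT e (proc p)    = cong proc (substP-renP e p)
  substT-renT e (proj v l)  = cong (λ w → proj w l) (substV-renV e v)
  substT-renT e (case v bs) = cong₂ case (substV-renV e v) (substB-renB e bs)
  substT-renT e (delta v w) = cong₂ delta (substV-renV e v) (substV-renV e w)

  substB-renB : ∀ {ρ σ σ′} → SubRen ρ σ σ′ → ∀ bs → substB σ (renB ρ bs) ≡ substB σ′ bs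
  substB-renB e []              = refl
  substB-renB e (branch C t bs) = cong₂ (branch C) (substT-renT (SubRen-liftλ e) t) (substB-renB e bs)

  substS-renS : ∀ {ρ σ σ′} → SubRen ρ σ σ′ → ∀ π → substS σ (renS ρ π) ≡ substS σ′ π
  substS-renS e (svar α)    = srμ e α
  substS-renS e (push v π)  = cong₂ push (substV-renV e v) (substS-renS e π)
  substS-renS e (frame t π) = cong₂ frame (substT-renT e t) (substS-renS e π)

  substP-renP : ∀ {ρ σ σ′} → SubRen ρ σ σ′ → ∀ p → substP σ (renP ρ p) ≡ substP σ′ p
  substP-renP e (t ∗ π) = cong₂ _∗_ (substT-renT e t) (substS-renS e π)

module _ {ρ : Ren} {σ σ′ τ : Subst} (sr : SubRen ρ σ τ) (rs : RenSub ρ σ′ τ) where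

  substV-renV-comm : ∀ v → substV σ (renV ρ v) ≡ renV ρ (substV σ′ v)
  substV-renV-comm v = trans (substV-renV sr v) (sym (renV-substV rs v))

  substT-renT-comm : ∀ t → substT σ (renT ρ t) ≡ renT ρ (substT σ′ t)
  substT-renT-comm t = trans (substT-renT sr t) (sym (renT-substT rs t))

  substS-renS-comm : ∀ π → substS σ (renS ρ π) ≡ renS ρ (substS σ′ π)
  substS-renS-comm π = trans (substS-renS sr π) (sym (renS-substS rs π))

weaken : Ren → Subst → Subst
weaken ρ σ = sub (λ x → renV ρ (σλ σ x)) (λ α → renS ρ (σμ σ α)) (λ a → renT ρ (σt σ a))

module _ (σ : Subst) where

  SubRen-liftλ-wkλ : SubRen wkλ (liftλ σ) (weaken wkλ σ)
  SubRen-liftλ-wkλ = mkSR (λ _ → refl) (λ _ → refl) (λ _ → refl)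

  SubRen-liftμ-wkμ : SubRen wkμ (liftμ σ) (weaken wkμ σ)
  SubRen-liftμ-wkμ = mkSR (λ _ → refl) (λ _ → refl) (λ _ → refl)

  RenSub-weaken : ∀ ρ → RenSub ρ σ (weaken ρ σ)
  RenSub-weaken ρ = mkRS (λ _ → refl) (λ _ → refl) (λ _ → refl)

record SubSub (σ τ υ : Subst) : Set where
  constructor mkSS
  field
    ssλ : ∀ x → substV τ (σλ σ x) ≡ σλ υ x
    ssμ : ∀ α → substS τ (σμ σ α) ≡ σμ υ α
    sst : ∀ a → substT τ (σt σ a) ≡ σt υ a
open SubSub

SubSub-liftλ : ∀ {σ τ υ} → SubSub σ τ υ → SubSub (liftλ σ) (liftλ τ) (liftλ υ)
SubSub-liftλ {σ} {τ} {υ} e = mkSS ss-zero-suc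
  (λ α → trans (substS-renS-comm sr rs (σμ σ α)) (cong (renS wkλ) (ssμ e α)))
  (λ a → trans (substT-renT-comm sr rs (σt σ a)) (cong (renT wkλ) (sst e a)))
  where
  sr : SubRen wkλ (liftλ τ) (weaken wkλ τ)
  sr = SubRen-liftλ-wkλ τ
  rs : RenSub wkλ τ (weaken wkλ τ)
  rs = RenSub-weaken τ wkλ
  ss-zero-suc : ∀ x → substV (liftλ τ) (σλ (liftλ σ) x) ≡ σλ (liftλ υ) x
  ss-zero-suc zero    = refl
  ss-zero-suc (suc x) = trans (substV-renV-comm sr rs (σλ σ x)) (cong (renV wkλ) (ssλ e x))

SubSub-liftμ : ∀ {σ τ υ} → SubSub σ τ υ → SubSub (liftμ σ) (liftμ τ) (liftμ υ)
SubSub-liftμ {σ} {τ} {υ} e = mkSS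
  (λ x → trans (substV-renV-comm sr rs (σλ σ x)) (cong (renV wkμ) (ssλ e x)))
  ss-zero-suc
  (λ a → trans (substT-renT-comm sr rs (σt σ a)) (cong (renT wkμ) (sst e a)))
  where
  sr : SubRen wkμ (liftμ τ) (weaken wkμ τ)
  sr = SubRen-liftμ-wkμ τ
  rs : RenSub wkμ τ (weaken wkμ τ)
  rs = RenSub-weaken τ wkμ
  ss-zero-suc : ∀ α → substS (liftμ τ) (σμ (liftμ σ) α) ≡ σμ (liftμ υ) α
  ss-zero-suc zero    = refl
  ss-zero-suc (suc α) = trans (substS-renS-comm sr rs (σμ σ α)) (cong (renS wkμ) (ssμ e α))

mutual
  substV-substV : ∀ {σ τ υ} → SubSub σ τ υ → ∀ v → substV τ (substV σ v) ≡ substV υ v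
  substV-substV e (var x)   = ssλ e x
  substV-substV e (lam t)   = cong lam (substT-substT (SubSub-liftλ e) t)
  substV-substV e (con C v) = cong (con C) (substV-substV e v)
  substV-substV e (rec fs)  = cong rec (substF-substF e fs)

  substF-substF : ∀ {σ τ υ} → SubSub σ τ υ → ∀ fs → substF τ (substF σ fs) ≡ substF υ fs
  substF-substF e []           = refl
  substF-substF e (fld l v fs) = cong₂ (fld l) (substV-substV e v) (substF-substF e fs)

  substT-substT : ∀ {σ τ υ} → SubSub σ τ υ → ∀ t → substT τ (substT σ t) ≡ substT υ t
  substT-substT e (tvar a)    = sst e a
  substT-substT e (val v)     = cong val (substV-substV e v)
  substT-substT e (app t u)   = cong₂ app (substT-substT e t) (substT-substT e u)
  substT-substT e (mu t)      = cong mu (substT-substT (SubSub-liftμ e) t)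
  substT-substT e (proc p)    = cong proc (substP-substP e p)
  substT-substT e (proj v l)  = cong (λ w → proj w l) (substV-substV e v)
  substT-substT e (case v bs) = cong₂ case (substV-substV e v) (substB-substB e bs)
  substT-substT e (delta v w) = cong₂ delta (substV-substV e v) (substV-substV e w)

  substB-substB : ∀ {σ τ υ} → SubSub σ τ υ → ∀ bs → substB τ (substB σ bs) ≡ substB υ bs
  substB-substB e []              = refl
  substB-substB e (branch C t bs) = cong₂ (branch C) (substT-substT (SubSub-liftλ e) t) (substB-substB e bs)

  substS-substS : ∀ {σ τ υ} → SubSub σ τ υ → ∀ π → substS τ (substS σ π) ≡ substS υ π
  substS-substS e (svar α)    = ssμ e α
  substS-substS e (push v π)  = cong₂ push (substV-substV e v) (substS-substS e π)
  substS-substS e (frame t π) = cong₂ frame (substT-substT e t) (substS-substS e π)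

  substP-substP : ∀ {σ τ υ} → SubSub σ τ υ → ∀ p → substP τ (substP σ p) ≡ substP υ p
  substP-substP e (t ∗ π) = cong₂ _∗_ (substT-substT e t) (substS-substS e π)

record IsIdentity (σ : Subst) : Set where
  constructor mkId
  field
    idλ : ∀ x → σλ σ x ≡ var x
    idμ : ∀ α → σμ σ α ≡ svar α
    idt : ∀ a → σt σ a ≡ tvar a
open IsIdentity

IsIdentity-liftλ : ∀ {σ} → IsIdentity σ → IsIdentity (liftλ σ)
IsIdentity-liftλ {σ} e =
  mkId id-zero-suc (λ α → cong (renS wkλ) (idμ e α)) (λ a → cong (renT wkλ) (idt e a))
  where
  id-zero-suc : ∀ x → σλ (liftλ σ) x ≡ var x
  id-zero-suc zero    = refl
  id-zero-suc (suc x) = cong (renV wkλ) (idλ e x)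

IsIdentity-liftμ : ∀ {σ} → IsIdentity σ → IsIdentity (liftμ σ)
IsIdentity-liftμ {σ} e =
  mkId (λ x → cong (renV wkμ) (idλ e x)) id-zero-suc (λ a → cong (renT wkμ) (idt e a))
  where
  id-zero-suc : ∀ α → σμ (liftμ σ) α ≡ svar α
  id-zero-suc zero    = refl
  id-zero-suc (suc α) = cong (renS wkμ) (idμ e α)

mutual
  substV-id : ∀ {σ} → IsIdentity σ → ∀ v → substV σ v ≡ v
  substV-id e (var x)   = idλ e x
  substV-id e (lam t)   = cong lam (substT-id (IsIdentity-liftλ e) t)
  substV-id e (con C v) = cong (con C) (substV-id e v)
  substV-id e (rec fs)  = cong rec (substF-id e fs)

  substF-id : ∀ {σ} → IsIdentity σ → ∀ fs → substF σ fs ≡ fs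
  substF-id e []           = refl
  substF-id e (fld l v fs) = cong₂ (fld l) (substV-id e v) (substF-id e fs)

  substT-id : ∀ {σ} → IsIdentity σ → ∀ t → substT σ t ≡ t
  substT-id e (tvar a)    = idt e a
  substT-id e (val v)     = cong val (substV-id e v)
  substT-id e (app t u)   = cong₂ app (substT-id e t) (substT-id e u)
  substT-id e (mu t)      = cong mu (substT-id (IsIdentity-liftμ e) t)
  substT-id e (proc p)    = cong proc (substP-id e p)
  substT-id e (proj v l)  = cong (λ w → proj w l) (substV-id e v)
  substT-id e (case v bs) = cong₂ case (substV-id e v) (substB-id e bs)
  substT-id e (delta v w) = cong₂ delta (substV-id e v) (substV-id e w)

  substB-id : ∀ {σ} → IsIdentity σ → ∀ bs → substB σ bs ≡ bs
  substB-id e []              = refl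
  substB-id e (branch C t bs) = cong₂ (branch C) (substT-id (IsIdentity-liftλ e) t) (substB-id e bs)

  substS-id : ∀ {σ} → IsIdentity σ → ∀ π → substS σ π ≡ π
  substS-id e (svar α)    = idμ e α
  substS-id e (push v π)  = cong₂ push (substV-id e v) (substS-id e π)
  substS-id e (frame t π) = cong₂ frame (substT-id e t) (substS-id e π)

  substP-id : ∀ {σ} → IsIdentity σ → ∀ p → substP σ p ≡ p
  substP-id e (t ∗ π) = cong₂ _∗_ (substT-id e t) (substS-id e π)

IsIdentity-idSubst : IsIdentity idSubst
IsIdentity-idSubst = mkId (λ _ → refl) (λ _ → refl) (λ _ → refl)

module _ {ρ : Ren} {σ : Subst} (e : SubRen ρ σ idSubst) where

  substV-renV-cancel : ∀ v → substV σ (renV ρ v) ≡ v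
  substV-renV-cancel v = trans (substV-renV e v) (substV-id IsIdentity-idSubst v)

  substT-renT-cancel : ∀ t → substT σ (renT ρ t) ≡ t
  substT-renT-cancel t = trans (substT-renT e t) (substT-id IsIdentity-idSubst t)

  substS-renS-cancel : ∀ π → substS σ (renS ρ π) ≡ π
  substS-renS-cancel π = trans (substS-renS e π) (substS-id IsIdentity-idSubst π)

instλ : Val → Subst → Subst
instλ v σ = sub (v ∷ₙ σλ σ) (σμ σ) (σt σ)

instμ : Stack → Subst → Subst
instμ π σ = sub (σλ σ) (π ∷ₙ σμ σ) (σt σ)

SubSub-liftλ-instλ : ∀ {σ S} → SubRen wkλ S idSubst → SubSub (liftλ σ) S (instλ (σλ S zero) σ)
SubSub-liftλ-instλ {σ} {S} e = mkSS ss-zero-suc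
  (λ α → substS-renS-cancel e (σμ σ α)) (λ a → substT-renT-cancel e (σt σ a))
  where
  ss-zero-suc : ∀ x → substV S (σλ (liftλ σ) x) ≡ σλ (instλ (σλ S zero) σ) x
  ss-zero-suc zero    = refl
  ss-zero-suc (suc x) = substV-renV-cancel e (σλ σ x)

SubSub-liftμ-instμ : ∀ {σ S} → SubRen wkμ S idSubst → SubSub (liftμ σ) S (instμ (σμ S zero) σ)
SubSub-liftμ-instμ {σ} {S} e = mkSS
  (λ x → substV-renV-cancel e (σλ σ x)) ss-zero-suc (λ a → substT-renT-cancel e (σt σ a))
  where
  ss-zero-suc : ∀ α → substS S (σμ (liftμ σ) α) ≡ σμ (instμ (σμ S zero) σ) α
  ss-zero-suc zero    = refl
  ss-zero-suc (suc α) = substS-renS-cancel e (σμ σ α)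

-- The substitutions inside _[λ:=_] and _[μ:=_] are local to their definitions, so they
-- are left to unification and their fusion hypotheses hold by computation.
module _ (σ : Subst) where
  open ≡-Reasoning

  substT-[λ:=] : ∀ t v → substT σ (t [λ:= v ]) ≡ substT (liftλ σ) t [λ:= substV σ v ]
  substT-[λ:=] t v = begin
    substT σ (t [λ:= v ])
      ≡⟨ substT-substT (mkSS (λ { zero → refl ; (suc _) → refl }) (λ _ → refl) (λ _ → refl)) t ⟩
    substT (instλ (substV σ v) σ) t
      ≡⟨ substT-substT (SubSub-liftλ-instλ (mkSR (λ _ → refl) (λ _ → refl) (λ _ → refl))) t ⟨
    substT (liftλ σ) t [λ:= substV σ v ] ∎

  substT-[μ:=] : ∀ t π → substT σ (t [μ:= π ]) ≡ substT (liftμ σ) t [μ:= substS σ π ]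
  substT-[μ:=] t π = begin
    substT σ (t [μ:= π ])
      ≡⟨ substT-substT (mkSS (λ _ → refl) (λ { zero → refl ; (suc _) → refl }) (λ _ → refl)) t ⟩
    substT (instμ (substS σ π) σ) t
      ≡⟨ substT-substT (SubSub-liftμ-instμ (mkSR (λ _ → refl) (λ _ → refl) (λ _ → refl))) t ⟨
    substT (liftμ σ) t [μ:= substS σ π ] ∎

module _ (σ : Subst) where

  ∈F-substF⁺ : ∀ {l v fs} → l ↦ v ∈F fs → l ↦ substV σ v ∈F substF σ fs
  ∈F-substF⁺ here      = here
  ∈F-substF⁺ (there m) = there (∈F-substF⁺ m)

  ∈B-substB⁺ : ∀ {C t bs} → C ⇒ t ∈B bs → C ⇒ substT (liftλ σ) t ∈B substB σ bs
  ∈B-substB⁺ here      = here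
  ∈B-substB⁺ (there m) = there (∈B-substB⁺ m)

  ∈F-substF⁻ : ∀ fs {l w} → l ↦ w ∈F substF σ fs → ∃ λ v → l ↦ v ∈F fs × w ≡ substV σ v
  ∈F-substF⁻ (fld l v fs) here = v , here , refl
  ∈F-substF⁻ (fld l v fs) (there m) with ∈F-substF⁻ fs m
  ... | v′ , m′ , eq = v′ , there m′ , eq

  ∈B-substB⁻ : ∀ bs {C u} → C ⇒ u ∈B substB σ bs → ∃ λ t → C ⇒ t ∈B bs × u ≡ substT (liftλ σ) t
  ∈B-substB⁻ (branch C t bs) here = t , here , refl
  ∈B-substB⁻ (branch C t bs) (there m) with ∈B-substB⁻ bs m
  ... | t′ , m′ , eq = t′ , there m′ , eq

lookupF? : ∀ l fs → Dec (∃ λ v → l ↦ v ∈F fs)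
lookupF? l [] = no λ ()
lookupF? l (fld l′ v fs) with l ≟ l′ | lookupF? l fs
... | yes refl | _            = yes (v , here)
... | no _     | yes (w , m)  = yes (w , there m)
... | no l≢l′  | no ∉fs       = no λ { (_ , here) → l≢l′ refl ; (w , there m) → ∉fs (w , m) }

lookupB? : ∀ C bs → Dec (∃ λ t → C ⇒ t ∈B bs)
lookupB? C [] = no λ ()
lookupB? C (branch C′ t bs) with C ≟ C′ | lookupB? C bs
... | yes refl | _            = yes (t , here)
... | no _     | yes (u , m)  = yes (u , there m)
... | no C≢C′  | no ∉bs       = no λ { (_ , here) → C≢C′ refl ; (u , there m) → ∉bs (u , m) }

≻-resp-≡ʳ : ∀ {p q q′} → q ≡ q′ → p ≻ q → p ≻ q′
≻-resp-≡ʳ refl s = s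

substP-≻⁺ : ∀ σ {p q} → p ≻ q → substP σ p ≻ substP σ q
substP-≻⁺ σ ≻-app                      = ≻-app
substP-≻⁺ σ ≻-val                      = ≻-val
substP-≻⁺ σ (≻-beta {t} {v} {π})       =
  ≻-resp-≡ʳ (cong (_∗ substS σ π) (sym (substT-[λ:=] σ t v))) ≻-beta
substP-≻⁺ σ (≻-mu {t} {π})             =
  ≻-resp-≡ʳ (cong (_∗ substS σ π) (sym (substT-[μ:=] σ t π))) ≻-mu
substP-≻⁺ σ ≻-proc                     = ≻-proc
substP-≻⁺ σ (≻-proj m)                 = ≻-proj (∈F-substF⁺ σ m)
substP-≻⁺ σ (≻-case {t = t} {v} {π} m) =
  ≻-resp-≡ʳ (cong (_∗ substS σ π) (sym (substT-[λ:=] σ t v))) (≻-case (∈B-substB⁺ σ m))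

-- Records may repeat a label, so ≻ is not deterministic: the step of pσ must be
-- traced back to a step of p rather than identified with the image of the given one.
substP-≻⁻ : ∀ σ {p q r} → p ≻ q → substP σ p ≻ r → ∃ λ p′ → p ≻ p′ × r ≡ substP σ p′
substP-≻⁻ σ ≻-app                 ≻-app = _ , ≻-app , refl
substP-≻⁻ σ ≻-val                 ≻-val = _ , ≻-val , refl
substP-≻⁻ σ (≻-beta {t} {v} {π})  ≻-beta = _ , ≻-beta , cong (_∗ substS σ π) (sym (substT-[λ:=] σ t v))
substP-≻⁻ σ (≻-mu {t} {π})        ≻-mu   = _ , ≻-mu , cong (_∗ substS σ π) (sym (substT-[μ:=] σ t π))
substP-≻⁻ σ ≻-proc                ≻-proc = _ , ≻-proc , refl
substP-≻⁻ σ (≻-proj {fs} _) (≻-proj m) with ∈F-substF⁻ σ fs m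
... | _ , m′ , refl = _ , ≻-proj m′ , refl
substP-≻⁻ σ (≻-case {bs} {v = v} {π} _) (≻-case m) with ∈B-substB⁻ σ bs m
... | t , m′ , refl = _ , ≻-case m′ , cong (_∗ substS σ π) (sym (substT-[λ:=] σ t v))

NonTerminating-¬Blocked : ∀ {p} → NonTerminating p → ¬ Blocked p
NonTerminating-¬Blocked {p} nt blocked = nt (p , ε , blocked)

NonTerminating-≻ : ∀ {p p′} → NonTerminating p → p ≻ p′ → NonTerminating p′
NonTerminating-≻ nt s (q , rs , blocked) = nt (q , s ◅ rs , blocked)

substP-≻*-¬Blocked : ∀ σ p {q} → NonTerminating p → substP σ p ≻* q → ¬ Blocked q
substP-≻*-¬Blocked σ p nt ε blocked =
  NonTerminating-¬Blocked nt λ { (_ , s) → blocked (_ , substP-≻⁺ σ s) }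
substP-≻*-¬Blocked σ p nt (_◅_ {j = r} s rs) blocked =
  NonTerminating-¬Blocked nt λ { (_ , s₀) → continue (substP-≻⁻ σ s₀ s) }
  where
  continue : ∃ (λ p′ → p ≻ p′ × r ≡ substP σ p′) → ⊥
  continue (p′ , s′ , refl) = substP-≻*-¬Blocked σ p′ (NonTerminating-≻ nt s′) rs blocked

NonTerminating-substP : ∀ σ p → NonTerminating p → NonTerminating (substP σ p)
NonTerminating-substP σ p nt (_ , rs , blocked) = substP-≻*-¬Blocked σ p nt rs blocked

data StuckShape : Proc → Set where
  con-push         : ∀ {C v w π} → StuckShape (val (con C v) ∗ push w π)
  rec-push         : ∀ {fs w π} → StuckShape (val (rec fs) ∗ push w π)
  proj-lam         : ∀ {t l π} → StuckShape (proj (lam t) l ∗ π)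
  proj-con         : ∀ {C v l π} → StuckShape (proj (con C v) l ∗ π)
  proj-rec-missing : ∀ {fs l π} → ¬ (∃ λ v → l ↦ v ∈F fs) → StuckShape (proj (rec fs) l ∗ π)
  case-lam         : ∀ {t bs π} → StuckShape (case (lam t) bs ∗ π)
  case-rec         : ∀ {fs bs π} → StuckShape (case (rec fs) bs ∗ π)
  case-var-[]      : ∀ {x π} → StuckShape (case (var x) [] ∗ π)
  case-con-missing : ∀ {C v bs π} → ¬ (∃ λ t → C ⇒ t ∈B bs) → StuckShape (case (con C v) bs ∗ π)

StuckShape-Blocked : ∀ {p} → StuckShape p → Blocked p
StuckShape-Blocked (proj-rec-missing ∉fs) (_ , ≻-proj m) = ∉fs (_ , m)
StuckShape-Blocked (case-con-missing ∉bs) (_ , ≻-case m) = ∉bs (_ , m)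

StuckShape-¬Final : ∀ {p} → StuckShape p → ¬ Final p
StuckShape-¬Final () (_ , _ , refl)

StuckShape-¬DeltaLike : ∀ {p} → StuckShape p → ¬ DeltaLike p
StuckShape-¬DeltaLike () (_ , _ , _ , refl)

case-[]-StuckShape : ∀ v π → StuckShape (case v [] ∗ π)
case-[]-StuckShape (var x)   π = case-var-[]
case-[]-StuckShape (lam t)   π = case-lam
case-[]-StuckShape (con C v) π = case-con-missing λ ()
case-[]-StuckShape (rec fs)  π = case-rec

StuckShape-substP : ∀ σ {p} → StuckShape p → StuckShape (substP σ p)
StuckShape-substP σ con-push = con-push
StuckShape-substP σ rec-push = rec-push
StuckShape-substP σ proj-lam = proj-lam
StuckShape-substP σ proj-con = proj-con
StuckShape-substP σ (proj-rec-missing {fs} ∉fs) =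
  proj-rec-missing λ { (_ , m) → let (v , m′ , _) = ∈F-substF⁻ σ fs m in ∉fs (v , m′) }
StuckShape-substP σ case-lam = case-lam
StuckShape-substP σ case-rec = case-rec
StuckShape-substP σ (case-var-[] {x} {π}) = case-[]-StuckShape (σλ σ x) (substS σ π)
StuckShape-substP σ (case-con-missing {bs = bs} ∉bs) =
  case-con-missing λ { (_ , m) → let (t , m′ , _) = ∈B-substB⁻ σ bs m in ∉bs (t , m′) }

StuckShape⇒Stuck : ∀ {p} → StuckShape p → Stuck p
StuckShape⇒Stuck sp =
  StuckShape-¬Final sp , StuckShape-¬DeltaLike sp , λ σ → StuckShape-Blocked (StuckShape-substP σ sp)

allλ : Val → Subst
allλ v = sub (λ _ → v) svar tvar

allt : Term → Subst
allt t = sub var svar (λ _ → t)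

Stuck-¬substP-≻ : ∀ {p} → Stuck p → ∀ σ {q} → ¬ (substP σ p ≻ q)
Stuck-¬substP-≻ (_ , _ , blocked) σ s = blocked σ (_ , s)

Stuck-Blocked : ∀ {p} → Stuck p → Blocked p
Stuck-Blocked st (_ , s) = Stuck-¬substP-≻ st idSubst (substP-≻⁺ idSubst s)

Stuck⇒StuckShape : ∀ p → Stuck p → StuckShape p
Stuck⇒StuckShape (tvar a ∗ π) st =
  ⊥-elim (Stuck-¬substP-≻ st (allt (app (tvar 0) (tvar 0))) ≻-app)
Stuck⇒StuckShape (val v ∗ svar α) (¬final , _) = ⊥-elim (¬final (v , α , refl))
Stuck⇒StuckShape (val v ∗ frame t π) st = ⊥-elim (Stuck-Blocked st (_ , ≻-val))
Stuck⇒StuckShape (val (var x) ∗ push w π) st =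
  ⊥-elim (Stuck-¬substP-≻ st (allλ (lam (val (var 0)))) ≻-beta)
Stuck⇒StuckShape (val (lam t) ∗ push w π) st = ⊥-elim (Stuck-Blocked st (_ , ≻-beta))
Stuck⇒StuckShape (val (con C v) ∗ push w π) _ = con-push
Stuck⇒StuckShape (val (rec fs) ∗ push w π) _ = rec-push
Stuck⇒StuckShape (app t u ∗ π) st = ⊥-elim (Stuck-Blocked st (_ , ≻-app))
Stuck⇒StuckShape (mu t ∗ π) st = ⊥-elim (Stuck-Blocked st (_ , ≻-mu))
Stuck⇒StuckShape (proc q ∗ π) st = ⊥-elim (Stuck-Blocked st (_ , ≻-proc))
Stuck⇒StuckShape (proj (var x) l ∗ π) st =
  ⊥-elim (Stuck-¬substP-≻ st (allλ (rec (fld l (var 0) []))) (≻-proj here))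
Stuck⇒StuckShape (proj (lam t) l ∗ π) _ = proj-lam
Stuck⇒StuckShape (proj (con C v) l ∗ π) _ = proj-con
Stuck⇒StuckShape (proj (rec fs) l ∗ π) st with lookupF? l fs
... | yes (_ , m) = ⊥-elim (Stuck-Blocked st (_ , ≻-proj m))
... | no ∉fs      = proj-rec-missing ∉fs
Stuck⇒StuckShape (case (var x) [] ∗ π) _ = case-var-[]
Stuck⇒StuckShape (case (var x) (branch C t bs) ∗ π) st =
  ⊥-elim (Stuck-¬substP-≻ st (allλ (con C (var 0))) (≻-case here))
Stuck⇒StuckShape (case (lam t) bs ∗ π) _ = case-lam
Stuck⇒StuckShape (case (rec fs) bs ∗ π) _ = case-rec
Stuck⇒StuckShape (case (con C v) bs ∗ π) st with lookupB? C bs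
... | yes (_ , m) = ⊥-elim (Stuck-Blocked st (_ , ≻-case m))
... | no ∉bs      = case-con-missing ∉bs
Stuck⇒StuckShape (delta v w ∗ π) (_ , ¬δ , _) = ⊥-elim (¬δ (v , w , π , refl))

DeltaLike-substP : ∀ σ {p} → DeltaLike p → DeltaLike (substP σ p)
DeltaLike-substP σ (v , w , π , refl) = substV σ v , substV σ w , substS σ π , refl

Stuck-substP : ∀ σ p → Stuck p → Stuck (substP σ p)
Stuck-substP σ p st = StuckShape⇒Stuck (StuckShape-substP σ (Stuck⇒StuckShape p st))

lemma2 : (p : Proc) (σ : Subst) →
    (DeltaLike p → DeltaLike (substP σ p)) ×
    (Stuck p → Stuck (substP σ p)) ×
    (NonTerminating p → NonTerminating (substP σ p))
lemma2 p σ = DeltaLike-substP σ , Stuck-substP σ p , NonTerminating-substP σ p
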